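{- If $G$ is an outerplanar graph, then the comparability graph of $P_G$ has a SegRay representation in which the vertices of $G$ are represented by horizontal segments (and the edges of $G$ by rays).
   Context: For a graph $G$, $P_G$ is its vertex-edge incidence poset (elements: vertices and edges of $G$; $v<e$ iff $v$ is an endpoint of $e$); its comparability graph is $G$ with every edge subdivided once. A SegRay representation of a graph is a finite family of horizontal segments and vertical rays all pointing in the same direction, in general position so that no two segments and no two rays intersect, whose intersection graph is the given graph. -}

module Defs where

open import Data.Nat using (ℕ)
open import Data.Fin using (Fin) renaming (_<_ to _<ᶠ_)
open import Data.Product using (Σ; ∃; _×_; _,_; proj₁; proj₂)
open import Data.Sum using (_⊎_)
open import Data.Bool using (Bool; true; false)
open import Data.Rational using (ℚ; _≤_; _<_)
open import Relation.Nullary using (¬_)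
open import Relation.Binary.PropositionalEquality using (_≡_; _≢_)
open import Function.Definitions using (Injective)

record Graph : Set where
  field
    n     : ℕ
    m     : ℕ
    ends  : Fin m → Fin n × Fin n
    loopless : ∀ e → proj₁ (ends e) ≢ proj₂ (ends e)
    simple   : ∀ e f →
      ((proj₁ (ends e) ≡ proj₁ (ends f) × proj₂ (ends e) ≡ proj₂ (ends f)) ⊎
       (proj₁ (ends e) ≡ proj₂ (ends f) × proj₂ (ends e) ≡ proj₁ (ends f))) →
      e ≡ f

open Graph public

-- v is an endpoint of e  (i.e. v < e in the incidence poset P_G)
_isEndOf_ : {G : Graph} → Fin (n G) → Fin (m G) → Set
_isEndOf_ {G} v e = v ≡ proj₁ (ends G e) ⊎ v ≡ proj₂ (ends G e)

-- Outerplanarity: the vertices can be placed (injectively) at positions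
-- 0..n-1 around a circle so that no two edges, drawn as chords, cross.

Between : ∀ {k} → Fin k → Fin k → Fin k → Set
Between a b x = (a <ᶠ x × x <ᶠ b) ⊎ (b <ᶠ x × x <ᶠ a)

Outside : ∀ {k} → Fin k → Fin k → Fin k → Set
Outside a b x = x ≢ a × x ≢ b × ¬ Between a b x

ChordsCross : ∀ {k} → Fin k → Fin k → Fin k → Fin k → Set
ChordsCross a b c d =
  (Between a b c × Outside a b d) ⊎ (Between a b d × Outside a b c)

Outerplanar : Graph → Set
Outerplanar G =
  Σ (Fin (n G) → Fin (n G)) λ pos →
    Injective _≡_ _≡_ pos ×
    (∀ e f → ¬ ChordsCross (pos (proj₁ (ends G e))) (pos (proj₂ (ends G e)))
                           (pos (proj₁ (ends G f))) (pos (proj₂ (ends G f))))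

record HSeg : Set where
  constructor hseg
  field
    left  : ℚ
    right : ℚ
    y     : ℚ
    nondeg : left < right

-- vertical ray with apex (x , base), pointing upward (up = true:
-- {(x , t) | t ≥ base}) or downward (up = false: {(x , t) | t ≤ base})
record VRay : Set where
  constructor vray
  field
    x    : ℚ
    base : ℚ

open HSeg public
open VRay public

SegsMeet : HSeg → HSeg → Set
SegsMeet s t = y s ≡ y t × left s ≤ right t × left t ≤ right s

RaysMeet : Bool → VRay → VRay → Set
RaysMeet _ r q = x r ≡ x q   -- two parallel rays, same direction, same line

SegRayMeet : Bool → HSeg → VRay → Set
SegRayMeet true  s r = left s ≤ x r × x r ≤ right s × base r ≤ y s
SegRayMeet false s r = left s ≤ x r × x r ≤ right s × y s ≤ base r

-- A SegRay representation of the comparability graph of P_G in which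
-- vertices of G are horizontal segments and edges of G are rays (all
-- pointing in the same direction `up`), such that no two segments and no
-- two rays intersect, and the intersection graph is exactly the
-- comparability graph of P_G (segment of v meets ray of e iff v < e).

record VertexSegEdgeRayRep (G : Graph) : Set where
  field
    up   : Bool
    seg  : Fin (n G) → HSeg
    ray  : Fin (m G) → VRay
    segsDisjoint : ∀ v w → v ≢ w → ¬ SegsMeet (seg v) (seg w)
    raysDisjoint : ∀ e f → e ≢ f → ¬ RaysMeet up (ray e) (ray f)
    incidence    : ∀ v e →
      (SegRayMeet up (seg v) (ray e) → _isEndOf_ {G} v e) ×
      (_isEndOf_ {G} v e → SegRayMeet up (seg v) (ray e))

-- Number the vertices by their position on the circle, so that every edge e becomes a span
-- lo e < hi e, and outerplanarity says that no two spans interleave. Vertex j is drawn as the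
-- segment at height j over [leftEnd j, j W + N], edge e as the downward ray from height hi e
-- at x = lo e W + (N - hi e), a point of the block [a W, a W + N] of its lower end a = lo e.
-- The segment of j is stretched left just far enough to reach the rays of the edges with top j.
-- A ray then misses every segment below it other than its lower end: for j < lo e the block
-- of j lies further left, and for lo e < j < hi e the segment of j only reaches the rays of
-- edges (c , j) with c ≥ lo e by non-interleaving, which lie to the right since N - j > N - hi e.

module Submission where

open import Defs
open import Data.Nat as ℕ
  using (ℕ; suc; _+_; _*_; _∸_; _⊓_; _⊔_; _≤_; _<_; z≤n; s≤s)
open import Data.Nat.Properties
open import Data.Nat.Coprimality using (1-coprimeTo)
import Data.Nat.Coprimality as Coprime
open import Data.Fin using (Fin; toℕ)
open import Data.Fin.Properties using (toℕ<n; toℕ-injective)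
open import Data.Integer as ℤ using (+_)
import Data.Integer.Properties as ℤ
open import Data.Rational as ℚ using (ℚ; mkℚ)
open import Data.List using (List; map; filter; allFin)
open import Data.List.Extrema.Nat using (min; min≤⊤; min≤xs; v<min⁺)
import Data.List.Relation.Unary.All as All
open import Data.List.Relation.Unary.All.Properties using (all-filter; map⁺)
open import Data.List.Membership.Propositional.Properties
  using (∈-allFin; ∈-filter⁺; ∈-map⁺)
open import Data.Product as Product using (_×_; _,_; proj₁; proj₂)
open import Data.Sum as Sum using (_⊎_; inj₁; inj₂)
open import Data.Bool using (false)
open import Function using (_∘_; _⇔_; mk⇔; Equivalence)
open import Function.Definitions using (Injective)
open import Function.Construct.Composition using (_⇔-∘_)
open import Function.Construct.Symmetry using (⇔-sym)
open import Relation.Nullary using (¬_; contradiction)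
open import Relation.Binary.Definitions using (tri<; tri≈; tri>)
open import Relation.Binary.PropositionalEquality
  using (_≡_; _≢_; refl; sym; cong; subst; subst₂)

fromℕ : ℕ → ℚ
fromℕ k = mkℚ (+ k) 0 (Coprime.sym (1-coprimeTo k))

fromℕ-mono-≤ : ∀ {k l} → k ≤ l → fromℕ k ℚ.≤ fromℕ l
fromℕ-mono-≤ {k} {l} k≤l =
  ℚ.*≤* (subst₂ ℤ._≤_ (sym (ℤ.*-identityʳ (+ k))) (sym (ℤ.*-identityʳ (+ l))) (ℤ.+≤+ k≤l))

fromℕ-mono-< : ∀ {k l} → k < l → fromℕ k ℚ.< fromℕ l
fromℕ-mono-< {k} {l} k<l =
  ℚ.*<* (subst₂ ℤ._<_ (sym (ℤ.*-identityʳ (+ k))) (sym (ℤ.*-identityʳ (+ l))) (ℤ.+<+ k<l))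

fromℕ-cancel-≤ : ∀ {k l} → fromℕ k ℚ.≤ fromℕ l → k ≤ l
fromℕ-cancel-≤ {k} {l} (ℚ.*≤* k≤l) =
  ℤ.drop‿+≤+ (subst₂ ℤ._≤_ (ℤ.*-identityʳ (+ k)) (ℤ.*-identityʳ (+ l)) k≤l)

fromℕ-injective : ∀ {k l} → fromℕ k ≡ fromℕ l → k ≡ l
fromℕ-injective = ℤ.+-injective ∘ cong ℚ.ℚ.numerator

*+-lex-< : ∀ {w a c} t s → t < w → a < c → a * w + t < c * w + s
*+-lex-< {w} {a} {c} t s t<w a<c = begin-strict
  a * w + t  <⟨ +-monoʳ-< (a * w) t<w ⟩
  a * w + w  ≡⟨ +-comm (a * w) w ⟩
  suc a * w  ≤⟨ *-monoˡ-≤ w a<c ⟩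
  c * w      ≤⟨ m≤m+n (c * w) s ⟩
  c * w + s  ∎
  where open ≤-Reasoning

*+-lex-injective : ∀ {w a c t s} → t < w → s < w → a * w + t ≡ c * w + s → a ≡ c × t ≡ s
*+-lex-injective {w} {a} {c} {t} {s} t<w s<w eq with <-cmp a c
... | tri< a<c _ _ = contradiction eq (<⇒≢ (*+-lex-< t s t<w a<c))
... | tri> _ _ c<a = contradiction (sym eq) (<⇒≢ (*+-lex-< s t s<w c<a))
... | tri≈ _ refl _ = refl , +-cancelˡ-≡ (a * w) t s eq

⊓<⊔ : ∀ {m n} → m ≢ n → m ⊓ n < m ⊔ n
⊓<⊔ {m} {n} m≢n with ≤-total m n
... | inj₁ m≤n rewrite m≤n⇒m⊓n≡m m≤n | m≤n⇒m⊔n≡n m≤n = ≤∧≢⇒< m≤n m≢n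
... | inj₂ n≤m rewrite m≥n⇒m⊓n≡n n≤m | m≥n⇒m⊔n≡m n≤m = ≤∧≢⇒< n≤m (m≢n ∘ sym)

≡⊎≡⇔≡⊓⊎≡⊔ : ∀ {x m n} → (x ≡ m ⊎ x ≡ n) ⇔ (x ≡ m ⊓ n ⊎ x ≡ m ⊔ n)
≡⊎≡⇔≡⊓⊎≡⊔ {x} {m} {n} with ≤-total m n
... | inj₁ m≤n rewrite m≤n⇒m⊓n≡m m≤n | m≤n⇒m⊔n≡n m≤n = mk⇔ (λ p → p) (λ p → p)
... | inj₂ n≤m rewrite m≥n⇒m⊓n≡n n≤m | m≥n⇒m⊔n≡m n≤m = mk⇔ Sum.swap Sum.swap

⊓⊔-injective : ∀ {m n m′ n′} → m ⊓ n ≡ m′ ⊓ n′ → m ⊔ n ≡ m′ ⊔ n′ →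
               (m ≡ m′ × n ≡ n′) ⊎ (m ≡ n′ × n ≡ m′)
⊓⊔-injective {m} {n} {m′} {n′} p q with ≤-total m n | ≤-total m′ n′
... | inj₁ m≤n | inj₁ m′≤n′
  rewrite m≤n⇒m⊓n≡m m≤n | m≤n⇒m⊔n≡n m≤n | m≤n⇒m⊓n≡m m′≤n′ | m≤n⇒m⊔n≡n m′≤n′
  = inj₁ (p , q)
... | inj₁ m≤n | inj₂ n′≤m′
  rewrite m≤n⇒m⊓n≡m m≤n | m≤n⇒m⊔n≡n m≤n | m≥n⇒m⊓n≡n n′≤m′ | m≥n⇒m⊔n≡m n′≤m′
  = inj₂ (p , q)
... | inj₂ n≤m | inj₁ m′≤n′
  rewrite m≥n⇒m⊓n≡n n≤m | m≥n⇒m⊔n≡m n≤m | m≤n⇒m⊓n≡m m′≤n′ | m≤n⇒m⊔n≡n m′≤n′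
  = inj₂ (q , p)
... | inj₂ n≤m | inj₂ n′≤m′
  rewrite m≥n⇒m⊓n≡n n≤m | m≥n⇒m⊔n≡m n≤m | m≥n⇒m⊓n≡n n′≤m′ | m≥n⇒m⊔n≡m n′≤m′
  = inj₁ (q , p)

between-⊓⊔ : ∀ {k} {A B X : Fin k} →
  toℕ A ⊓ toℕ B < toℕ X → toℕ X < toℕ A ⊔ toℕ B → Between A B X
between-⊓⊔ {A = A} {B} p q with ≤-total (toℕ A) (toℕ B)
... | inj₁ A≤B rewrite m≤n⇒m⊓n≡m A≤B | m≤n⇒m⊔n≡n A≤B = inj₁ (p , q)
... | inj₂ B≤A rewrite m≥n⇒m⊓n≡n B≤A | m≥n⇒m⊔n≡m B≤A = inj₂ (p , q)

outside-< : ∀ {k} {A B Y : Fin k} → toℕ Y < toℕ A ⊓ toℕ B → Outside A B Y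
outside-< {A = A} {B} Y<A⊓B = Y≢A , Y≢B , ¬between
  where
  Y<A = <-≤-trans Y<A⊓B (m⊓n≤m (toℕ A) (toℕ B))
  Y<B = <-≤-trans Y<A⊓B (m⊓n≤n (toℕ A) (toℕ B))
  Y≢A = <⇒≢ Y<A ∘ cong toℕ
  Y≢B = <⇒≢ Y<B ∘ cong toℕ
  ¬between : ¬ Between A B _
  ¬between (inj₁ (A<Y , _)) = <-asym A<Y Y<A
  ¬between (inj₂ (B<Y , _)) = <-asym B<Y Y<B

chordsCross-interleaved : ∀ {k} (A B C D : Fin k) →
  toℕ C ⊓ toℕ D < toℕ A ⊓ toℕ B → toℕ A ⊓ toℕ B < toℕ C ⊔ toℕ D →
  toℕ C ⊔ toℕ D < toℕ A ⊔ toℕ B → ChordsCross A B C D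
chordsCross-interleaved A B C D p q r with ≤-total (toℕ C) (toℕ D)
... | inj₁ C≤D rewrite m≤n⇒m⊓n≡m C≤D | m≤n⇒m⊔n≡n C≤D =
  inj₂ (between-⊓⊔ {A = A} {B} q r , outside-< {A = A} {B} p)
... | inj₂ D≤C rewrite m≥n⇒m⊓n≡n D≤C | m≥n⇒m⊔n≡m D≤C =
  inj₁ (between-⊓⊔ {A = A} {B} q r , outside-< {A = A} {B} p)

module NestedSpanLayout
  (N M : ℕ) (lo hi : Fin M → ℕ)
  (lo<hi : ∀ e → lo e < hi e)
  (hi<N : ∀ e → hi e < N)
  (nonInterleaving : ∀ e f → ¬ (lo f < lo e × lo e < hi f × hi f < hi e))
  (span-injective : ∀ e f → lo e ≡ lo f → hi e ≡ hi f → e ≡ f)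
  where

  W : ℕ
  W = suc N

  N∸<W : ∀ j → N ∸ j < W
  N∸<W j = s≤s (m∸n≤m N j)

  rayX : Fin M → ℕ
  rayX e = lo e * W + (N ∸ hi e)

  edgesWithTop : ℕ → List (Fin M)
  edgesWithTop j = filter (λ f → hi f ℕ.≟ j) (allFin M)

  leftEnd : ℕ → ℕ
  leftEnd j = min (j * W) (map rayX (edgesWithTop j))

  rightEnd : ℕ → ℕ
  rightEnd j = j * W + N

  leftEnd≤j*W : ∀ j → leftEnd j ≤ j * W
  leftEnd≤j*W j = min≤⊤ (j * W) (map rayX (edgesWithTop j))

  leftEnd<rightEnd : ∀ j → 0 < N → leftEnd j < rightEnd j
  leftEnd<rightEnd j 0<N = ≤-<-trans (leftEnd≤j*W j) (m<m+n (j * W) 0<N)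

  leftEnd≤rayX : ∀ e → leftEnd (hi e) ≤ rayX e
  leftEnd≤rayX e = All.lookup (min≤xs (hi e * W) (map rayX (edgesWithTop (hi e))))
    (∈-map⁺ rayX (∈-filter⁺ (λ f → hi f ℕ.≟ hi e) (∈-allFin e) refl))

  rayX<rayX : ∀ {e f j} → lo e < j → j < hi e → hi f ≡ j → rayX e < rayX f
  rayX<rayX {e} {f} lo<j j<hi refl with <-cmp (lo e) (lo f)
  ... | tri< lo<lo _ _ = *+-lex-< _ _ (N∸<W (hi e)) lo<lo
  ... | tri≈ _ lo≡lo _ rewrite lo≡lo = +-monoʳ-< (lo f * W) (∸-monoʳ-< j<hi (<⇒≤ (hi<N e)))
  ... | tri> _ _ lo>lo = contradiction (lo>lo , lo<j , j<hi) (nonInterleaving e f)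

  rayX<leftEnd : ∀ {e j} → lo e < j → j < hi e → rayX e < leftEnd j
  rayX<leftEnd {e} {j} lo<j j<hi = v<min⁺ rayX<jW
    (map⁺ (All.map (rayX<rayX lo<j j<hi) (all-filter (λ f → hi f ℕ.≟ j) (allFin M))))
    where
    rayX<jW : rayX e < j * W
    rayX<jW = subst (rayX e <_) (+-identityʳ (j * W)) (*+-lex-< _ 0 (N∸<W (hi e)) lo<j)

  rayX-injective : ∀ {e f} → rayX e ≡ rayX f → e ≡ f
  rayX-injective {e} {f} eq with *+-lex-injective (N∸<W (hi e)) (N∸<W (hi f)) eq
  ... | lo≡lo , N∸hi≡N∸hi =
    span-injective e f lo≡lo (∸-cancelˡ-≡ (<⇒≤ (hi<N e)) (<⇒≤ (hi<N f)) N∸hi≡N∸hi)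

  Hits : ℕ → Fin M → Set
  Hits j e = leftEnd j ≤ rayX e × rayX e ≤ rightEnd j × j ≤ hi e

  hits⇒end : ∀ {j e} → Hits j e → j ≡ lo e ⊎ j ≡ hi e
  hits⇒end {j} {e} (leftEnd≤x , x≤rightEnd , j≤hi) with <-cmp j (lo e) | <-cmp j (hi e)
  ... | tri≈ _ j≡lo _ | _             = inj₁ j≡lo
  ... | _             | tri≈ _ j≡hi _ = inj₂ j≡hi
  ... | tri< j<lo _ _ | _             =
    contradiction x≤rightEnd (<⇒≱ (*+-lex-< N _ (n<1+n N) j<lo))
  ... | tri> _ _ lo<j | tri< j<hi _ _ = contradiction leftEnd≤x (<⇒≱ (rayX<leftEnd lo<j j<hi))
  ... | tri> _ _ _    | tri> _ _ hi<j = contradiction j≤hi (<⇒≱ hi<j)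

  end⇒hits : ∀ {j e} → j ≡ lo e ⊎ j ≡ hi e → Hits j e
  end⇒hits {e = e} (inj₁ refl) =
    ≤-trans (leftEnd≤j*W (lo e)) (m≤m+n _ _) , +-monoʳ-≤ (lo e * W) (m∸n≤m N (hi e)) , <⇒≤ (lo<hi e)
  end⇒hits {e = e} (inj₂ refl) =
    leftEnd≤rayX e , <⇒≤ (*+-lex-< _ N (N∸<W (hi e)) (lo<hi e)) , ≤-refl

  hits⇔end : ∀ {j e} → Hits j e ⇔ (j ≡ lo e ⊎ j ≡ hi e)
  hits⇔end = mk⇔ hits⇒end end⇒hits

module OuterplanarRepresentation
  (G : Graph) (pos : Fin (n G) → Fin (n G)) (pos-injective : Injective _≡_ _≡_ pos)
  (noCrossing : ∀ e f → ¬ ChordsCross (pos (proj₁ (ends G e))) (pos (proj₂ (ends G e)))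
                                      (pos (proj₁ (ends G f))) (pos (proj₂ (ends G f))))
  where

  P : Fin (n G) → ℕ
  P v = toℕ (pos v)

  P-injective : Injective _≡_ _≡_ P
  P-injective = pos-injective ∘ toℕ-injective

  lo hi : Fin (m G) → ℕ
  lo e = P (proj₁ (ends G e)) ⊓ P (proj₂ (ends G e))
  hi e = P (proj₁ (ends G e)) ⊔ P (proj₂ (ends G e))

  lo<hi : ∀ e → lo e < hi e
  lo<hi e = ⊓<⊔ (loopless G e ∘ P-injective)

  hi<n : ∀ e → hi e < n G
  hi<n e = ⊔-pres-<m (toℕ<n (pos (proj₁ (ends G e)))) (toℕ<n (pos (proj₂ (ends G e))))

  nonInterleaving : ∀ e f → ¬ (lo f < lo e × lo e < hi f × hi f < hi e)
  nonInterleaving e f (p , q , r) = noCrossing e f (chordsCross-interleaved _ _ _ _ p q r)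

  span-injective : ∀ e f → lo e ≡ lo f → hi e ≡ hi f → e ≡ f
  span-injective e f lo≡lo hi≡hi = simple G e f
    (Sum.map (Product.map P-injective P-injective) (Product.map P-injective P-injective)
      (⊓⊔-injective lo≡lo hi≡hi))

  isEndOf⇔ : ∀ {v e} → _isEndOf_ {G} v e ⇔ (P v ≡ lo e ⊎ P v ≡ hi e)
  isEndOf⇔ = ≡⊎≡⇔≡⊓⊎≡⊔ ⇔-∘ mk⇔ (Sum.map (cong P) (cong P)) (Sum.map P-injective P-injective)

  open NestedSpanLayout (n G) (m G) lo hi lo<hi hi<n nonInterleaving span-injective public

  segment : Fin (n G) → HSeg
  segment v = hseg (fromℕ (leftEnd (P v))) (fromℕ (rightEnd (P v))) (fromℕ (P v))
    (fromℕ-mono-< (leftEnd<rightEnd (P v) (≤-<-trans z≤n (toℕ<n (pos v)))))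

  ray : Fin (m G) → VRay
  ray e = vray (fromℕ (rayX e)) (fromℕ (hi e))

  segRayMeet⇔hits : ∀ {v e} → SegRayMeet false (segment v) (ray e) ⇔ Hits (P v) e
  segRayMeet⇔hits = mk⇔
    (Product.map fromℕ-cancel-≤ (Product.map fromℕ-cancel-≤ fromℕ-cancel-≤))
    (Product.map fromℕ-mono-≤ (Product.map fromℕ-mono-≤ fromℕ-mono-≤))

proposition13 : (G : Graph) → Outerplanar G → VertexSegEdgeRayRep G
proposition13 G (pos , pos-injective , noCrossing) = record
  { up           = false
  ; seg          = segment
  ; ray          = ray
  ; segsDisjoint = λ v w v≢w (y≡y , _) → v≢w (P-injective (fromℕ-injective y≡y))
  ; raysDisjoint = λ e f e≢f x≡x → e≢f (rayX-injective (fromℕ-injective x≡x))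
  ; incidence    = λ v e →
      let open Equivalence (⇔-sym isEndOf⇔ ⇔-∘ (hits⇔end ⇔-∘ segRayMeet⇔hits)) in to , from
  }
  where open OuterplanarRepresentation G pos pos-injective noCrossing
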